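{- Let $\omega=\mathtt{w}_1\mathtt{w}_2\cdots\mathtt{w}_n$ be a necklace in $\mathbf{W}(n)\setminus\mathbf{W}_1(n)$ and let $1\le i\le n$. If $\mathtt{w}_i>1$, let $\mathtt{y}$ be the largest symbol occurring in $\omega$ that is smaller than $\mathtt{w}_i$; otherwise let $\mathtt{y}=1$. If $\mathtt{w}_1\cdots\mathtt{w}_{i-1}\mathtt{y}\mathtt{w}_{i+1}\cdots\mathtt{w}_n$ is not a necklace, then $\mathtt{c}_i=-1$.
   Context: Alphabet $\{1,\dots,n\}$ with natural order; a necklace is a string lexicographically smallest among its rotations. A weak order of order $n$ is a string $\omega=\mathtt{w}_1\cdots\mathtt{w}_n$ over $\{1,\dots,n\}$ with $\mathtt{w}_i=1+|\{j:\mathtt{w}_j<\mathtt{w}_i\}|$ for all $i$; $\mathbf{W}(n)$ is the set of them. $n_\omega(s)$ denotes the number of occurrences of $s$ in $\omega$; $\mathbf{W}_1(n)$ is the set of $\omega\in\mathbf{W}(n)$ in which no symbol other than possibly 1 occurs more than once. The tree $\mathcal{T}_{weak}$ has as nodes the necklaces of $\mathbf{W}(n)$ (standing for their rotation classes), rooted at $1^n$; for a non-root necklace $\omega$: if $\omega\in\mathbf{W}_1(n)$, let $j$ be the index of the symbol $n_\omega(1)+1$ and $\mathtt{x}=1$; otherwise let $j$ be the largest index holding a symbol other than 1 that occurs more than once in $\omega$, and $\mathtt{x}=\mathtt{w}_j+n_\omega(\mathtt{w}_j)-1$; the parent of $\omega$ is the necklace of $\mathtt{w}_1\cdots\mathtt{w}_{j-1}\mathtt{x}\mathtt{w}_{j+1}\cdots\mathtt{w}_n$.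 For a node $\omega$ of $\mathcal{T}_{weak}$ and $1\le i\le n$, $\mathtt{c}_i=\mathtt{x}$ if there is a symbol $\mathtt{x}$ such that the necklace of $\mathtt{w}_1\cdots\mathtt{w}_{i-1}\mathtt{x}\mathtt{w}_{i+1}\cdots\mathtt{w}_n$ is a child of $\omega$ in $\mathcal{T}_{weak}$, and $\mathtt{c}_i=-1$ otherwise. -}

module Defs where

open import Data.Nat using (ℕ; zero; suc; _+_; _∸_; _<_; _≤_; _<ᵇ_; _≡ᵇ_)
open import Data.Nat.Properties using (_≟_; _<?_)
open import Data.Bool using (Bool; true; false; if_then_else_; T; not; _∧_; _∨_)
open import Data.List using (List; []; _∷_; length; drop; take; _++_; filter; map; foldr; upTo; replicate)
open import Data.List.Relation.Unary.All using (All)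
open import Data.Sum using (_⊎_)
open import Data.Product using (_×_)
open import Relation.Binary.PropositionalEquality using (_≡_)
open import Relation.Nullary using (¬_)

-- Strings over {1,…,n} are lists of naturals; n is the length.
-- Positions are 0-based: position k here is the paper's index k+1.
Word : Set
Word = List ℕ

-- k-th entry (0-based), default 0 out of range
at : Word → ℕ → ℕ
at []       _       = 0
at (a ∷ _)  zero    = a
at (_ ∷ w)  (suc k) = at w k

setAt : Word → ℕ → ℕ → Word
setAt []      _       _ = []
setAt (_ ∷ w) zero    x = x ∷ w
setAt (a ∷ w) (suc k) x = a ∷ setAt w k x

rotate : ℕ → Word → Word
rotate k w = drop k w ++ take k w

leqB : Word → Word → Bool
leqB []       _        = true
leqB (_ ∷ _)  []       = false
leqB (x ∷ xs) (y ∷ ys) = if x <ᵇ y then true else (if x ≡ᵇ y then leqB xs ys else false)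

IsNecklace : Word → Set
IsNecklace w = ∀ k → k < length w → T (leqB w (rotate k w))

minLex : Word → Word → Word
minLex a b = if leqB a b then a else b

neck : Word → Word
neck w = foldr minLex w (map (λ k → rotate k w) (upTo (length w)))

count : ℕ → Word → ℕ
count s w = length (filter (λ a → a ≟ s) w)

countLess : ℕ → Word → ℕ
countLess a w = length (filter (λ b → b <? a) w)

IsWeakOrder : Word → Set
IsWeakOrder w = All (λ a → a ≡ suc (countLess a w)) w

InW1 : Word → Set
InW1 w = All (λ a → a ≡ 1 ⊎ count a w ≡ 1) w

isW1B : Word → Bool
isW1B w = foldr (λ a r → ((a ≡ᵇ 1) ∨ (count a w ≡ᵇ 1)) ∧ r) true w

indexOf : ℕ → Word → ℕ
indexOf s []      = 0
indexOf s (a ∷ w) = if a ≡ᵇ s then 0 else suc (indexOf s w)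

isDupNonOne : Word → ℕ → Bool
isDupNonOne w a = not (a ≡ᵇ 1) ∧ (1 <ᵇ count a w)

lastDupIdx : Word → ℕ
lastDupIdx w = foldr (λ k r → if isDupNonOne w (at w k) then k else r) 0
                     (reverseUpTo (length w))
  where
  reverseUpTo : ℕ → List ℕ
  reverseUpTo zero    = []
  reverseUpTo (suc m) = m ∷ reverseUpTo m

parentWord : Word → Word
parentWord w =
  if isW1B w
  then setAt w (indexOf (suc (count 1 w)) w) 1
  else setAt w (lastDupIdx w) (at w (lastDupIdx w) + count (at w (lastDupIdx w)) w ∸ 1)

parent : Word → Word
parent w = neck (parentWord w)

IsChild : Word → Word → Set
IsChild τ ω =
  length τ ≡ length ω × IsWeakOrder τ × IsNecklace τ
  × ¬ (τ ≡ replicate (length ω) 1) × parent τ ≡ ω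

-- Let σ be a child of ω. If σ ∈ W₁, so is its parent ω: setting a symbol to 1 and rotating
-- preserves W₁. Otherwise ω comes from σ by raising the last repeated symbol a ≠ 1, at position j,
-- to b = a + n_σ(a) − 1. As σ is a weak order, none of its symbols lies in (a, b]; raising the last
-- occurrence of a across such a gap keeps σ a necklace, so ω is σ[j := b] itself, not merely its
-- necklace. Now σ is a rotation of ω[i := x] and b ∉ σ, so i = j; there the largest symbol of ω
-- below ω_i = b is y = a, and ω[i := y] = σ is a necklace.
module Submission where

open import Defs
open import Data.Bool using (Bool; true; false; T; _∧_; _∨_; if_then_else_)
open import Data.Bool.Properties using (T-≡; T-∧; T-∨)
open import Data.Empty using (⊥; ⊥-elim)
open import Data.List using (List; []; _∷_; length; drop; take; _++_; map; foldr; upTo)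
open import Data.List.Properties using (length-drop; take++drop≡id; ++-identityʳ)
open import Data.List.Relation.Unary.All as All using (All)
open import Data.List.Relation.Unary.Any using (Any; here; there)
open import Data.List.Membership.Propositional using (_∈_)
open import Data.List.Membership.Propositional.Properties using (∈-map⁻; ∈-upTo⁻)
open import Data.List.Relation.Binary.Permutation.Propositional using (_↭_; ↭-sym; ↭-trans; ↭-reflexive)
open import Data.List.Relation.Binary.Permutation.Propositional.Properties
  using (++-comm; ∈-resp-↭; ↭-length; filter-↭; All-resp-↭)
open import Data.Nat using (ℕ; zero; suc; _+_; _∸_; _<_; _≤_; z≤n; s≤s; _<ᵇ_; _≡ᵇ_)
open import Data.Nat.Properties
open import Data.Nat.Induction using (<-rec)
open import Data.Product using (_×_; ∃; _,_; proj₁; proj₂)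
open import Data.Sum as Sum using (_⊎_; inj₁; inj₂)
open import Function using (_∘_; case_of_)
open import Function.Bundles using (Equivalence)
open import Relation.Binary.PropositionalEquality
open import Relation.Nullary using (¬_; yes; no)
open import Relation.Nullary.Reflects using (Reflects; ofʸ; ofⁿ; fromEquivalence)

open Equivalence using (to; from)

length-setAt : ∀ w j v → length (setAt w j v) ≡ length w
length-setAt []      j       v = refl
length-setAt (x ∷ w) zero    v = refl
length-setAt (x ∷ w) (suc j) v = cong suc (length-setAt w j v)

at-setAt-≡ : ∀ w j v → j < length w → at (setAt w j v) j ≡ v
at-setAt-≡ (x ∷ w) zero    v _         = refl
at-setAt-≡ (x ∷ w) (suc j) v (s≤s j<) = at-setAt-≡ w j v j<

at-setAt-≢ : ∀ w j v k → k ≢ j → at (setAt w j v) k ≡ at w k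
at-setAt-≢ []      j       v k       k≢j = refl
at-setAt-≢ (x ∷ w) zero    v zero    k≢j = ⊥-elim (k≢j refl)
at-setAt-≢ (x ∷ w) zero    v (suc k) k≢j = refl
at-setAt-≢ (x ∷ w) (suc j) v zero    k≢j = refl
at-setAt-≢ (x ∷ w) (suc j) v (suc k) k≢j = at-setAt-≢ w j v k (k≢j ∘ cong suc)

at-setAt-mono : ∀ w j v k → at w j ≤ v → at w k ≤ at (setAt w j v) k
at-setAt-mono []      j       v k       _  = ≤-refl
at-setAt-mono (x ∷ w) zero    v zero    le = le
at-setAt-mono (x ∷ w) zero    v (suc k) _  = ≤-refl
at-setAt-mono (x ∷ w) (suc j) v zero    _  = ≤-refl
at-setAt-mono (x ∷ w) (suc j) v (suc k) le = at-setAt-mono w j v k le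

setAt-setAt : ∀ w j u v → setAt (setAt w j u) j v ≡ setAt w j v
setAt-setAt []      j       u v = refl
setAt-setAt (x ∷ w) zero    u v = refl
setAt-setAt (x ∷ w) (suc j) u v = cong (x ∷_) (setAt-setAt w j u v)

setAt-at : ∀ w j → setAt w j (at w j) ≡ w
setAt-at []      j       = refl
setAt-at (x ∷ w) zero    = refl
setAt-at (x ∷ w) (suc j) = cong (x ∷_) (setAt-at w j)

at-∈ : ∀ w k → k < length w → at w k ∈ w
at-∈ (x ∷ w) zero    _         = here refl
at-∈ (x ∷ w) (suc k) (s≤s k<) = there (at-∈ w k k<)

∈-setAt⁻ : ∀ {z} w j v → z ∈ setAt w j v → z ≡ v ⊎ z ∈ w
∈-setAt⁻ (x ∷ w) zero    v (here z≡v) = inj₁ z≡v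
∈-setAt⁻ (x ∷ w) zero    v (there z∈) = inj₂ (there z∈)
∈-setAt⁻ (x ∷ w) (suc j) v (here z≡x) = inj₂ (here z≡x)
∈-setAt⁻ (x ∷ w) (suc j) v (there z∈) with ∈-setAt⁻ w j v z∈
... | inj₁ z≡v = inj₁ z≡v
... | inj₂ z∈w = inj₂ (there z∈w)

at-++ˡ : ∀ xs ys m → m < length xs → at (xs ++ ys) m ≡ at xs m
at-++ˡ (x ∷ xs) ys zero    _         = refl
at-++ˡ (x ∷ xs) ys (suc m) (s≤s m<) = at-++ˡ xs ys m m<

at-++ʳ : ∀ xs ys m → at (xs ++ ys) (length xs + m) ≡ at ys m
at-++ʳ []       ys m = refl
at-++ʳ (x ∷ xs) ys m = at-++ʳ xs ys m

at-drop : ∀ t w m → at (drop t w) m ≡ at w (t + m)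
at-drop zero    w       m = refl
at-drop (suc t) []      m = refl
at-drop (suc t) (x ∷ w) m = at-drop t w m

at-take : ∀ t w m → m < t → at (take t w) m ≡ at w m
at-take (suc t) []      m       _         = refl
at-take (suc t) (x ∷ w) zero    _         = refl
at-take (suc t) (x ∷ w) (suc m) (s≤s m<) = at-take t w m m<

setAt-++ˡ : ∀ xs ys k v → k < length xs → setAt (xs ++ ys) k v ≡ setAt xs k v ++ ys
setAt-++ˡ (x ∷ xs) ys zero    v _         = refl
setAt-++ˡ (x ∷ xs) ys (suc k) v (s≤s k<) = cong (x ∷_) (setAt-++ˡ xs ys k v k<)

setAt-++ʳ : ∀ xs ys k v → setAt (xs ++ ys) (length xs + k) v ≡ xs ++ setAt ys k v
setAt-++ʳ []       ys k v = refl
setAt-++ʳ (x ∷ xs) ys k v = cong (x ∷_) (setAt-++ʳ xs ys k v)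

drop-setAt-< : ∀ t w j v → j < t → drop t (setAt w j v) ≡ drop t w
drop-setAt-< (suc t) []      j       v _         = refl
drop-setAt-< (suc t) (x ∷ w) zero    v _         = refl
drop-setAt-< (suc t) (x ∷ w) (suc j) v (s≤s j<) = drop-setAt-< t w j v j<

take-setAt-< : ∀ t w j v → j < t → take t (setAt w j v) ≡ setAt (take t w) j v
take-setAt-< (suc t) []      j       v _         = refl
take-setAt-< (suc t) (x ∷ w) zero    v _         = refl
take-setAt-< (suc t) (x ∷ w) (suc j) v (s≤s j<) = cong (x ∷_) (take-setAt-< t w j v j<)

drop-setAt-≥ : ∀ t w j v → t ≤ j → drop t (setAt w j v) ≡ setAt (drop t w) (j ∸ t) v
drop-setAt-≥ zero    w       j       v _         = refl
drop-setAt-≥ (suc t) []      j       v _         = refl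
drop-setAt-≥ (suc t) (x ∷ w) (suc j) v (s≤s t≤) = drop-setAt-≥ t w j v t≤

take-setAt-≥ : ∀ t w j v → t ≤ j → take t (setAt w j v) ≡ take t w
take-setAt-≥ zero    w       j       v _         = refl
take-setAt-≥ (suc t) []      j       v _         = refl
take-setAt-≥ (suc t) (x ∷ w) (suc j) v (s≤s t≤) = cong (x ∷_) (take-setAt-≥ t w j v t≤)

drop-length-++ : ∀ (xs ys : List ℕ) → drop (length xs) (xs ++ ys) ≡ ys
drop-length-++ []       ys = refl
drop-length-++ (x ∷ xs) ys = drop-length-++ xs ys

take-length-++ : ∀ (xs ys : List ℕ) → take (length xs) (xs ++ ys) ≡ xs
take-length-++ []       ys = refl
take-length-++ (x ∷ xs) ys = cong (x ∷_) (take-length-++ xs ys)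

rotate-↭ : ∀ t w → rotate t w ↭ w
rotate-↭ t w = ↭-trans (++-comm (drop t w) (take t w)) (↭-reflexive (take++drop≡id t w))

length-rotate : ∀ t w → length (rotate t w) ≡ length w
length-rotate t w = ↭-length (rotate-↭ t w)

∈-rotate⁻ : ∀ {z} t w → z ∈ rotate t w → z ∈ w
∈-rotate⁻ t w = ∈-resp-↭ (rotate-↭ t w)

at-rotate-front : ∀ t w m → m < length w ∸ t → at (rotate t w) m ≡ at w (t + m)
at-rotate-front t w m m< =
  trans (at-++ˡ (drop t w) (take t w) m (subst (m <_) (sym (length-drop t w)) m<)) (at-drop t w m)

at-rotate-back : ∀ t w r → r < t → at (rotate t w) (length w ∸ t + r) ≡ at w r
at-rotate-back t w r r<t = begin
  at (rotate t w) (length w ∸ t + r)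
    ≡⟨ cong (λ k → at (rotate t w) (k + r)) (sym (length-drop t w)) ⟩
  at (drop t w ++ take t w) (length (drop t w) + r)
    ≡⟨ at-++ʳ (drop t w) (take t w) r ⟩
  at (take t w) r
    ≡⟨ at-take t w r r<t ⟩
  at w r ∎
  where open ≡-Reasoning

rotate-setAt-≥ : ∀ t w j v → t ≤ j → j < length w →
  rotate t (setAt w j v) ≡ setAt (rotate t w) (j ∸ t) v
rotate-setAt-≥ t w j v t≤j j<n = begin
  drop t (setAt w j v) ++ take t (setAt w j v)
    ≡⟨ cong₂ _++_ (drop-setAt-≥ t w j v t≤j) (take-setAt-≥ t w j v t≤j) ⟩
  setAt (drop t w) (j ∸ t) v ++ take t w
    ≡⟨ sym (setAt-++ˡ (drop t w) (take t w) (j ∸ t) v j∸t<) ⟩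
  setAt (rotate t w) (j ∸ t) v ∎
  where
  open ≡-Reasoning
  j∸t< : j ∸ t < length (drop t w)
  j∸t< = subst (j ∸ t <_) (sym (length-drop t w)) (∸-monoˡ-< j<n t≤j)

rotate-setAt-< : ∀ t w j v → j < t →
  rotate t (setAt w j v) ≡ setAt (rotate t w) (length w ∸ t + j) v
rotate-setAt-< t w j v j<t = begin
  drop t (setAt w j v) ++ take t (setAt w j v)
    ≡⟨ cong₂ _++_ (drop-setAt-< t w j v j<t) (take-setAt-< t w j v j<t) ⟩
  drop t w ++ setAt (take t w) j v
    ≡⟨ sym (setAt-++ʳ (drop t w) (take t w) j v) ⟩
  setAt (rotate t w) (length (drop t w) + j) v
    ≡⟨ cong (λ k → setAt (rotate t w) (k + j) v) (length-drop t w) ⟩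
  setAt (rotate t w) (length w ∸ t + j) v ∎
  where open ≡-Reasoning

rotate-inverse : ∀ t w → rotate (length w ∸ t) (rotate t w) ≡ w
rotate-inverse t w = begin
  rotate (length w ∸ t) (drop t w ++ take t w)
    ≡⟨ cong (λ k → rotate k (drop t w ++ take t w)) (sym (length-drop t w)) ⟩
  rotate (length (drop t w)) (drop t w ++ take t w)
    ≡⟨ cong₂ _++_ (drop-length-++ (drop t w) (take t w)) (take-length-++ (drop t w) (take t w)) ⟩
  take t w ++ drop t w
    ≡⟨ take++drop≡id t w ⟩
  w ∎
  where open ≡-Reasoning

≡ᵇ-reflects-≡ : ∀ m n → Reflects (m ≡ n) (m ≡ᵇ n)
≡ᵇ-reflects-≡ m n = fromEquivalence (≡ᵇ⇒≡ m n) (≡⇒≡ᵇ m n)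

Agree : Word → Word → ℕ → Set
Agree u v d = ∀ m → m < d → at u m ≡ at v m

Agree-∷ : ∀ {x u v d} → Agree u v d → Agree (x ∷ u) (x ∷ v) (suc d)
Agree-∷ agree zero    _         = refl
Agree-∷ agree (suc m) (s≤s m<d) = agree m m<d

FirstDiff : Word → Word → Set
FirstDiff u v = ∃ λ d → d < length u × Agree u v d × at u d < at v d

leqB-sound : ∀ u v → length u ≡ length v → T (leqB u v) →
  ∃ λ d → d ≤ length u × Agree u v d × (d < length u → at u d < at v d)
leqB-sound []       []       _   _ = 0 , z≤n , (λ _ ()) , λ ()
leqB-sound (x ∷ xs) (y ∷ ys) len le with x <ᵇ y | <ᵇ-reflects-< x y
... | true  | ofʸ x<y = 0 , z≤n , (λ _ ()) , λ _ → x<y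
... | false | _ with x ≡ᵇ y | ≡ᵇ-reflects-≡ x y
...   | true | ofʸ refl =
        let d , d≤ , agree , strict = leqB-sound xs ys (suc-injective len) le
        in suc d , s≤s d≤ , Agree-∷ agree , strict ∘ ≤-pred

leqB-complete : ∀ u v → FirstDiff u v → T (leqB u v)
leqB-complete (x ∷ xs) (y ∷ ys) (d , d< , agree , lt) with x <ᵇ y | <ᵇ-reflects-< x y
... | true  | _       = _
... | false | ofⁿ x≮y with d | x ≡ᵇ y | ≡ᵇ-reflects-≡ x y
...   | zero  | _     | _          = ⊥-elim (x≮y lt)
...   | suc _ | false | ofⁿ x≢y    = ⊥-elim (x≢y (agree 0 (s≤s z≤n)))
...   | suc d′ | true | ofʸ _      =
        leqB-complete xs ys (d′ , ≤-pred d< , (λ m m< → agree (suc m) (s≤s m<)) , lt)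

leqB-refl : ∀ u → T (leqB u u)
leqB-refl []       = _
leqB-refl (x ∷ xs) with x <ᵇ x | <ᵇ-reflects-< x x
... | true  | _ = _
... | false | _ with x ≡ᵇ x | ≡ᵇ-reflects-≡ x x
...   | true  | _       = leqB-refl xs
...   | false | ofⁿ x≢x = ⊥-elim (x≢x refl)

leqB-antisym : ∀ u v → T (leqB u v) → T (leqB v u) → u ≡ v
leqB-antisym []       []       _  _  = refl
leqB-antisym (x ∷ xs) (y ∷ ys) le ge
  with x <ᵇ y | <ᵇ-reflects-< x y | y <ᵇ x | <ᵇ-reflects-< y x
... | true  | ofʸ x<y | true  | ofʸ y<x = ⊥-elim (<-asym x<y y<x)
... | true  | ofʸ x<y | false | _ with y ≡ᵇ x | ≡ᵇ-reflects-≡ y x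
...   | true | ofʸ refl = ⊥-elim (<-irrefl refl x<y)
leqB-antisym (x ∷ xs) (y ∷ ys) le ge | false | _ | true | ofʸ y<x with x ≡ᵇ y | ≡ᵇ-reflects-≡ x y
...   | true | ofʸ refl = ⊥-elim (<-irrefl refl y<x)
leqB-antisym (x ∷ xs) (y ∷ ys) le ge | false | _ | false | _ with x ≡ᵇ y | ≡ᵇ-reflects-≡ x y
...   | true | ofʸ refl with x ≡ᵇ x | ≡ᵇ-reflects-≡ x x
...     | true  | _       = cong (x ∷_) (leqB-antisym xs ys le ge)
...     | false | ofⁿ x≢x = ⊥-elim (x≢x refl)

foldr-minLex-∈ : ∀ z xs → foldr minLex z xs ≡ z ⊎ foldr minLex z xs ∈ xs
foldr-minLex-∈ z []       = inj₁ refl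
foldr-minLex-∈ z (x ∷ xs) with leqB x (foldr minLex z xs)
... | true  = inj₂ (here refl)
... | false with foldr-minLex-∈ z xs
...   | inj₁ ≡z = inj₁ ≡z
...   | inj₂ ∈xs = inj₂ (there ∈xs)

neck-rotation : ∀ w → neck w ≡ w ⊎ ∃ λ s → s < length w × neck w ≡ rotate s w
neck-rotation w with foldr-minLex-∈ w (map (λ k → rotate k w) (upTo (length w)))
... | inj₁ ≡w = inj₁ ≡w
... | inj₂ ∈rotations =
      let s , s∈ , ≡rot = ∈-map⁻ (λ k → rotate k w) ∈rotations in inj₂ (s , ∈-upTo⁻ s∈ , ≡rot)

neck-↭ : ∀ w → neck w ↭ w
neck-↭ w with neck-rotation w
... | inj₁ ≡w           = ↭-reflexive ≡w
... | inj₂ (s , _ , ≡rot) = ↭-trans (↭-reflexive ≡rot) (rotate-↭ s w)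

rotate-necklace-unique : ∀ s w → s < length w → IsNecklace w → IsNecklace (rotate s w) → rotate s w ≡ w
rotate-necklace-unique zero    w _  _   _      = ++-identityʳ w
rotate-necklace-unique (suc s) w s< w-nk rot-nk =
  sym (leqB-antisym w (rotate (suc s) w) (w-nk (suc s) s<) back)
  where
  back : T (leqB (rotate (suc s) w) w)
  back = subst (T ∘ leqB (rotate (suc s) w)) (rotate-inverse (suc s) w)
    (rot-nk (length w ∸ suc s)
      (subst (length w ∸ suc s <_) (sym (length-rotate (suc s) w)) (∸-monoʳ-< (s≤s z≤n) (<⇒≤ s<))))

neck-necklace : ∀ w → IsNecklace w → IsNecklace (neck w) → neck w ≡ w
neck-necklace w w-nk neck-nk with neck-rotation w
... | inj₁ ≡w             = ≡w
... | inj₂ (s , s< , ≡rot) =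
      trans ≡rot (rotate-necklace-unique s w s< w-nk (subst IsNecklace ≡rot neck-nk))

count-↭ : ∀ a {xs ys} → xs ↭ ys → count a xs ≡ count a ys
count-↭ a p = ↭-length (filter-↭ (_≟ a) p)

count-pos : ∀ {a} w → a ∈ w → 0 < count a w
count-pos {a} (x ∷ w) a∈ with x ≡ᵇ a | ≡ᵇ-reflects-≡ x a | a∈
... | true  | _        | _          = s≤s z≤n
... | false | ofⁿ x≢a | here a≡x   = ⊥-elim (x≢a (sym a≡x))
... | false | _        | there a∈w = count-pos w a∈w

count-pos⁻ : ∀ {a} w → 0 < count a w → a ∈ w
count-pos⁻ {a} (x ∷ w) pos with x ≡ᵇ a | ≡ᵇ-reflects-≡ x a
... | true  | ofʸ x≡a = here (sym x≡a)
... | false | _        = there (count-pos⁻ w pos)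

count-setAt-≤ : ∀ {a v} w j → a ≢ v → count a (setAt w j v) ≤ count a w
count-setAt-≤         []      j       a≢v = z≤n
count-setAt-≤ {a} {v} (x ∷ w) zero    a≢v with v ≡ᵇ a | ≡ᵇ-reflects-≡ v a | x ≡ᵇ a
... | true  | ofʸ v≡a | _     = ⊥-elim (a≢v (sym v≡a))
... | false | _        | true  = n≤1+n _
... | false | _        | false = ≤-refl
count-setAt-≤ {a}     (x ∷ w) (suc j) a≢v with x ≡ᵇ a
... | true  = s≤s (count-setAt-≤ w j a≢v)
... | false = count-setAt-≤ w j a≢v

count-setAt-removes : ∀ {v} w j → j < length w → v ≢ at w j →
  suc (count (at w j) (setAt w j v)) ≡ count (at w j) w
count-setAt-removes {v} (x ∷ w) zero    _         v≢x
  with v ≡ᵇ x | ≡ᵇ-reflects-≡ v x | x ≡ᵇ x | ≡ᵇ-reflects-≡ x x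
... | true  | ofʸ v≡x | _     | _        = ⊥-elim (v≢x v≡x)
... | false | _        | true  | _        = refl
... | false | _        | false | ofⁿ x≢x = ⊥-elim (x≢x refl)
count-setAt-removes     (x ∷ w) (suc j) (s≤s j<) v≢a with x ≡ᵇ at w j
... | true  = cong suc (count-setAt-removes w j j< v≢a)
... | false = count-setAt-removes w j j< v≢a

countLess+count≤countLess : ∀ {a z} w → a < z → countLess a w + count a w ≤ countLess z w
countLess+count≤countLess         []      a<z = z≤n
countLess+count≤countLess {a} {z} (x ∷ w) a<z
  with x <ᵇ a | <ᵇ-reflects-< x a | x ≡ᵇ a | ≡ᵇ-reflects-≡ x a | x <ᵇ z | <ᵇ-reflects-< x z
... | true  | ofʸ x<a | true  | ofʸ x≡a | _     | _        = ⊥-elim (<-irrefl x≡a x<a)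
... | true  | ofʸ x<a | false | _        | false | ofⁿ x≮z = ⊥-elim (x≮z (<-trans x<a a<z))
... | true  | _        | false | _        | true  | _        = s≤s (countLess+count≤countLess w a<z)
... | false | _        | true  | ofʸ x≡a | false | ofⁿ x≮z = ⊥-elim (x≮z (subst (_< z) (sym x≡a) a<z))
... | false | _        | true  | _        | true  | _        =
      subst (_≤ suc (countLess z w)) (sym (+-suc _ _)) (s≤s (countLess+count≤countLess w a<z))
... | false | _        | false | _        | true  | _        = m≤n⇒m≤1+n (countLess+count≤countLess w a<z)
... | false | _        | false | _        | false | _        = countLess+count≤countLess w a<z

weakOrder-gap : ∀ {w a z} → IsWeakOrder w → a ∈ w → z ∈ w → a < z → a + count a w ≤ z
weakOrder-gap {w} {a} {z} wo a∈ z∈ a<z =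
  subst₂ _≤_ (cong (_+ count a w) (sym (All.lookup wo a∈))) (sym (All.lookup wo z∈))
    (s≤s (countLess+count≤countLess w a<z))

InW1-↭ : ∀ {u v} → u ↭ v → InW1 u → InW1 v
InW1-↭ {u} {v} p w₁ = All-resp-↭ p (All.map (λ {a} → Sum.map₂ (trans (sym (count-↭ a p)))) w₁)

InW1-setAt-1 : ∀ w j → InW1 w → InW1 (setAt w j 1)
InW1-setAt-1 w j w₁ = All.tabulate single
  where
  single : ∀ {z} → z ∈ setAt w j 1 → z ≡ 1 ⊎ count z (setAt w j 1) ≡ 1
  single {z} z∈ with z ≟ 1 | ∈-setAt⁻ w j 1 z∈
  ... | yes z≡1 | _          = inj₁ z≡1
  ... | no z≢1  | inj₁ z≡1   = ⊥-elim (z≢1 z≡1)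
  ... | no z≢1  | inj₂ z∈w with All.lookup w₁ z∈w
  ...   | inj₁ z≡1 = ⊥-elim (z≢1 z≡1)
  ...   | inj₂ once =
          inj₂ (≤-antisym (subst (count z (setAt w j 1) ≤_) once (count-setAt-≤ w j z≢1))
                          (count-pos (setAt w j 1) z∈))

foldr-∧-All : ∀ (f : ℕ → Bool) xs → T (foldr (λ a r → f a ∧ r) true xs) → All (T ∘ f) xs
foldr-∧-All f []       _  = All.[]
foldr-∧-All f (x ∷ xs) all = let fx , rest = to T-∧ all in fx All.∷ foldr-∧-All f xs rest

foldr-∧-Any : ∀ (f : ℕ → Bool) xs → foldr (λ a r → f a ∧ r) true xs ≡ false →
  Any (λ a → f a ≡ false) xs
foldr-∧-Any f (x ∷ xs) ff with f x in fx
... | true  = there (foldr-∧-Any f xs ff)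
... | false = here fx

Any-at : ∀ {P : ℕ → Set} w → Any P w → ∃ λ k → k < length w × P (at w k)
Any-at (x ∷ w) (here px)  = 0 , s≤s z≤n , px
Any-at (x ∷ w) (there pw) = let k , k< , pk = Any-at w pw in suc k , s≤s k< , pk

isW1B-sound : ∀ w → isW1B w ≡ true → InW1 w
isW1B-sound w ok = All.map (λ {a} → Sum.map (≡ᵇ⇒≡ a 1) (≡ᵇ⇒≡ (count a w) 1) ∘ to T-∨)
  (foldr-∧-All (λ a → (a ≡ᵇ 1) ∨ (count a w ≡ᵇ 1)) w (from T-≡ ok))

isDupNonOne-intro : ∀ w {z} → z ∈ w → ((z ≡ᵇ 1) ∨ (count z w ≡ᵇ 1)) ≡ false →
  isDupNonOne w z ≡ true
isDupNonOne-intro w {z} z∈ neither with z ≡ᵇ 1 | count z w ≡ᵇ 1 | ≡ᵇ-reflects-≡ (count z w) 1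
... | false | false | ofⁿ c≢1 = to T-≡ (<⇒<ᵇ (≤∧≢⇒< (count-pos w z∈) (c≢1 ∘ sym)))

isW1B-false : ∀ w → isW1B w ≡ false → ∃ λ k → k < length w × isDupNonOne w (at w k) ≡ true
isW1B-false w notW₁ =
  let k , k< , bad = Any-at w (foldr-∧-Any (λ a → (a ≡ᵇ 1) ∨ (count a w ≡ᵇ 1)) w notW₁)
  in k , k< , isDupNonOne-intro w (at-∈ w k k<) bad

isDupNonOne⇒repeated : ∀ w a → isDupNonOne w a ≡ true → 1 < count a w
isDupNonOne⇒repeated w a dup = <ᵇ⇒< 1 (count a w) (proj₂ (to T-∧ (from T-≡ dup)))

IsLast : (ℕ → Bool) → ℕ → ℕ → Set
IsLast D n j = j < n × D j ≡ true × (∀ q → j < q → q < n → D q ≡ false)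

isLast-by-recursion : ∀ (D : ℕ → Bool) (f : ℕ → ℕ) →
  (∀ m → f (suc m) ≡ (if D m then m else f m)) →
  ∀ n k → k < n → D k ≡ true → IsLast D n (f n)
isLast-by-recursion D f f-suc (suc m) k k< Dk rewrite f-suc m with D m in Dm
... | true  = ≤-refl , Dm , λ q m<q q<sm → ⊥-elim (<-irrefl refl (<-≤-trans m<q (≤-pred q<sm)))
... | false =
  let j< , Dj , later = isLast-by-recursion D f f-suc m k k<m Dk
  in m<n⇒m<1+n j< , Dj , λ q j<q q<sm → extend q j<q q<sm later
  where
  k<m : k < m
  k<m = ≤∧≢⇒< (≤-pred k<) λ { refl → case trans (sym Dk) Dm of λ () }
  extend : ∀ {j} q → j < q → q < suc m → (∀ q → j < q → q < m → D q ≡ false) → D q ≡ false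
  extend q j<q q<sm later with q ≟ m
  ... | yes refl = Dm
  ... | no q≢m   = later q j<q (≤∧≢⇒< (≤-pred q<sm) q≢m)

-- reverseUpTo is local to lastDupIdx; abstracting over length w lets unification supply
-- the recursion equation of the fold it drives.
lastDupIdx-isLast : ∀ w k → k < length w → isDupNonOne w (at w k) ≡ true →
  IsLast (λ q → isDupNonOne w (at w q)) (length w) (lastDupIdx w)
lastDupIdx-isLast w with length w | isLast-by-recursion (λ q → isDupNonOne w (at w q)) _ (λ _ → refl)
... | n | isLast = isLast n

Agree-setAt : ∀ {d} u j c v p c′ → Agree u v d → d ≤ j → d ≤ p → Agree (setAt u j c) (setAt v p c′) d
Agree-setAt u j c v p c′ agree d≤j d≤p m m<d = begin
  at (setAt u j c) m   ≡⟨ at-setAt-≢ u j c m (<⇒≢ (<-≤-trans m<d d≤j)) ⟩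
  at u m               ≡⟨ agree m m<d ⟩
  at v m               ≡⟨ sym (at-setAt-≢ v p c′ m (<⇒≢ (<-≤-trans m<d d≤p))) ⟩
  at (setAt v p c′) m  ∎
  where open ≡-Reasoning

setAt-firstDiff : ∀ u v d {j p c c′} → d < length u → Agree u v d → at u d < at v d →
  d ≤ j → d ≤ p → at v p ≤ c′ → (d ≡ j → c < at v d) →
  FirstDiff (setAt u j c) (setAt v p c′)
setAt-firstDiff u v d {j} {p} {c} {c′} d< agree u<v d≤j d≤p vp≤c′ new< =
  d , subst (d <_) (sym (length-setAt u j c)) d< , Agree-setAt u j c v p c′ agree d≤j d≤p ,
  <-≤-trans left< (at-setAt-mono v p c′ d vp≤c′)
  where
  left< : at (setAt u j c) d < at v d
  left< with d ≟ j
  ... | yes refl = subst (_< at v d) (sym (at-setAt-≡ u d c d<)) (new< refl)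
  ... | no d≢j   = subst (_< at v d) (sym (at-setAt-≢ u j c d d≢j)) u<v

setAt-firstDiff-at : ∀ u v p {j c c′} → length u ≡ length v → p < length u → p < j →
  Agree u v (suc p) → at v p < c′ → FirstDiff (setAt u j c) (setAt v p c′)
setAt-firstDiff-at u v p {j} {c} {c′} len p< p<j agree vp<c′ =
  p , subst (p <_) (sym (length-setAt u j c)) p< ,
  Agree-setAt u j c v p c′ (λ m m<p → agree m (m<n⇒m<1+n m<p)) (<⇒≤ p<j) ≤-refl ,
  subst₂ _<_ (sym left≡) (sym (at-setAt-≡ v p c′ (subst (p <_) len p<))) vp<c′
  where
  left≡ : at (setAt u j c) p ≡ at v p
  left≡ = trans (at-setAt-≢ u j c p (<⇒≢ p<j)) (agree p ≤-refl)

-- Agreement with the rotation makes w periodic with period s = n ∸ t below d, so descending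
-- from j by s reaches a position below s, whose symbol reappears t places later, beyond j.
rotation-agreement-repeats : ∀ w t d j → j < t → t < length w → j < d → Agree w (rotate t w) d →
  ∃ λ q → j < q × q < length w × at w q ≡ at w j
rotation-agreement-repeats w t d j j<t t<n j<d agree = <-rec P descend j ≤-refl refl
  where
  open ≡-Reasoning
  n = length w
  s = n ∸ t
  P : ℕ → Set
  P q = q ≤ j → at w q ≡ at w j → ∃ λ q′ → j < q′ × q′ < n × at w q′ ≡ at w j
  descend : ∀ q → (∀ {r} → r < q → P r) → P q
  descend q rec q≤j wq≡wj with q <? s
  ... | yes q<s = t + q , <-≤-trans j<t (m≤m+n t q) , t+q<n , (begin
        at w (t + q)       ≡⟨ sym (at-rotate-front t w q q<s) ⟩
        at (rotate t w) q  ≡⟨ sym (agree q (≤-<-trans q≤j j<d)) ⟩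
        at w q             ≡⟨ wq≡wj ⟩
        at w j             ∎)
    where
    t+q<n : t + q < n
    t+q<n = subst (t + q <_) (m+[n∸m]≡n (<⇒≤ t<n)) (+-monoʳ-< t q<s)
  ... | no q≮s = rec r<q (<⇒≤ (<-≤-trans r<q q≤j)) (begin
        at w r                   ≡⟨ sym (at-rotate-back t w r r<t) ⟩
        at (rotate t w) (s + r)  ≡⟨ cong (at (rotate t w)) s+r≡q ⟩
        at (rotate t w) q        ≡⟨ sym (agree q (≤-<-trans q≤j j<d)) ⟩
        at w q                   ≡⟨ wq≡wj ⟩
        at w j                   ∎)
    where
    r = q ∸ s
    s+r≡q : s + r ≡ q
    s+r≡q = m+[n∸m]≡n (≮⇒≥ q≮s)
    r<q : r < q
    r<q = subst (r <_) s+r≡q (m<n+m r (m<n⇒0<n∸m t<n))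
    r<t : r < t
    r<t = +-cancelˡ-< s r t (subst₂ _<_ (sym s+r≡q) (sym (m∸n+n≡m (<⇒≤ t<n)))
            (≤-<-trans q≤j (<-trans j<t t<n)))

-- The rotation of ρ = σ[j := b] by t is τ[p := b], where τ = rotate t σ and τ_p = σ_j = a.
-- A first difference d ≤ min(j, p) of σ and τ persists (at d = j because of the gap above a);
-- otherwise p < j, as p > j would make a reappear after j, and ρ first falls below at p.
raise-preserves-necklace : ∀ σ j b → IsNecklace σ → j < length σ → at σ j < b →
  (∀ q → j < q → q < length σ → at σ q ≢ at σ j) →
  (∀ z → z ∈ σ → at σ j < z → b < z) →
  IsNecklace (setAt σ j b)
raise-preserves-necklace σ j b σ-nk j<n a<b last gap zero _ =
  subst (T ∘ leqB ρ) (sym (++-identityʳ ρ)) (leqB-refl ρ)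
  where ρ = setAt σ j b
raise-preserves-necklace σ j b σ-nk j<n a<b last gap t@(suc _) t<∣ρ∣ =
  leqB-complete ρ (rotate t ρ) (below-rotation (leqB-sound σ τ (sym (length-rotate t σ)) (σ-nk t t<n)))
  where
  ρ = setAt σ j b
  τ = rotate t σ
  n = length σ
  t<n : t < n
  t<n = subst (t <_) (length-setAt σ j b) t<∣ρ∣
  above-gap : ∀ d → d < n → d ≡ j → at σ d < at τ d → b < at τ d
  above-gap d d<n refl σd<τd =
    gap (at τ d) (∈-rotate⁻ t σ (at-∈ τ d (subst (d <_) (sym (length-rotate t σ)) d<n))) σd<τd
  below-rotation : (∃ λ d → d ≤ n × Agree σ τ d × (d < n → at σ d < at τ d)) →
    FirstDiff ρ (rotate t ρ)
  below-rotation (d , _ , agree , strict) with t ≤? j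
  ... | yes t≤j = subst (FirstDiff ρ) (sym (rotate-setAt-≥ t σ j b t≤j j<n)) raised
    where
    p = j ∸ t
    p<j : p < j
    p<j = ∸-monoʳ-< {o = 0} (s≤s z≤n) t≤j
    τp<b : at τ p < b
    τp<b = subst (_< b) (sym (trans (at-rotate-front t σ p (∸-monoˡ-< j<n t≤j))
                                     (cong (at σ) (m+[n∸m]≡n t≤j)))) a<b
    raised : FirstDiff ρ (setAt τ p b)
    raised with p <? d
    ... | yes p<d = setAt-firstDiff-at σ τ p (sym (length-rotate t σ)) (<-trans p<j j<n) p<j
                      (λ m m≤p → agree m (<-≤-trans m≤p p<d)) τp<b
    ... | no p≮d  = setAt-firstDiff σ τ d d<n agree (strict d<n)
                      (≤-trans d≤p (<⇒≤ p<j)) d≤p (<⇒≤ τp<b)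
                      (λ d≡j → above-gap d d<n d≡j (strict d<n))
      where
      d≤p = ≮⇒≥ p≮d
      d<n = ≤-<-trans d≤p (<-trans p<j j<n)
  ... | no t≰j = subst (FirstDiff ρ) (sym (rotate-setAt-< t σ j b j<t)) raised
    where
    j<t = ≰⇒> t≰j
    p = n ∸ t + j
    τp<b : at τ p < b
    τp<b = subst (_< b) (sym (at-rotate-back t σ j j<t)) a<b
    raised : FirstDiff ρ (setAt τ p b)
    raised with j <? d
    ... | yes j<d = let q , j<q , q<n , repeat = rotation-agreement-repeats σ t d j j<t t<n j<d agree
                    in ⊥-elim (last q j<q q<n repeat)
    ... | no j≮d  = setAt-firstDiff σ τ d d<n agree (strict d<n)
                      d≤j (≤-trans d≤j (m≤n+m j (n ∸ t))) (<⇒≤ τp<b)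
                      (λ d≡j → above-gap d d<n d≡j (strict d<n))
      where
      d≤j = ≮⇒≥ j≮d
      d<n = ≤-<-trans d≤j j<n

parentWord-W1 : ∀ w → isW1B w ≡ true → parentWord w ≡ setAt w (indexOf (suc (count 1 w)) w) 1
parentWord-W1 w w₁ rewrite w₁ = refl

parentWord-nonW1 : ∀ w → isW1B w ≡ false →
  parentWord w ≡ setAt w (lastDupIdx w) (at w (lastDupIdx w) + count (at w (lastDupIdx w)) w ∸ 1)
parentWord-nonW1 w notW₁ rewrite notW₁ = refl

parent-InW1 : ∀ σ → isW1B σ ≡ true → InW1 (parent σ)
parent-InW1 σ w₁ = subst (InW1 ∘ neck) (sym (parentWord-W1 σ w₁))
  (InW1-↭ (↭-sym (neck-↭ _)) (InW1-setAt-1 σ _ (isW1B-sound σ w₁)))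

record Raise (σ ω : Word) : Set where
  field
    j a b : ℕ
    j<n   : j < length σ
    σj≡a  : at σ j ≡ a
    0<a   : 0 < a
    a<b   : a < b
    ω≡    : ω ≡ setAt σ j b
    a∈ω   : a ∈ ω
    gap   : ∀ z → z ∈ σ → a < z → b < z

parent-Raise : ∀ σ → IsWeakOrder σ → IsNecklace σ → isW1B σ ≡ false → IsNecklace (parent σ) →
  Raise σ (parent σ)
parent-Raise σ wo σ-nk notW₁ parent-nk = record
  { j = j ; a = a ; b = b ; j<n = j<n ; σj≡a = refl ; 0<a = 0<a ; a<b = a<b
  ; ω≡ = parent≡ρ ; a∈ω = subst (a ∈_) (sym parent≡ρ) a∈ρ ; gap = gap }
  where
  j = lastDupIdx σ
  a = at σ j
  c = count a σ
  b = a + c ∸ 1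
  ρ = setAt σ j b
  isLast : IsLast (λ q → isDupNonOne σ (at σ q)) (length σ) j
  isLast = let k , k< , dup = isW1B-false σ notW₁ in lastDupIdx-isLast σ k k< dup
  j<n = proj₁ isLast
  dup = proj₁ (proj₂ isLast)
  later = proj₂ (proj₂ isLast)
  1<c : 1 < c
  1<c = isDupNonOne⇒repeated σ a dup
  b≡a+c-1 : b ≡ a + (c ∸ 1)
  b≡a+c-1 = +-∸-assoc a (<⇒≤ 1<c)
  a<b : a < b
  a<b = subst (a <_) (sym b≡a+c-1) (m<m+n a (m<n⇒0<n∸m 1<c))
  b<a+c : b < a + c
  b<a+c = subst (_< a + c) (sym b≡a+c-1) (+-monoʳ-< a (∸-monoʳ-< {o = 0} (s≤s z≤n) (<⇒≤ 1<c)))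
  0<a : 0 < a
  0<a = subst (0 <_) (sym (All.lookup wo (at-∈ σ j j<n))) (s≤s z≤n)
  gap : ∀ z → z ∈ σ → a < z → b < z
  gap z z∈ a<z = <-≤-trans b<a+c (weakOrder-gap wo (at-∈ σ j j<n) z∈ a<z)
  last : ∀ q → j < q → q < length σ → at σ q ≢ a
  last q j<q q<n same =
    case trans (sym (later q j<q q<n)) (trans (cong (isDupNonOne σ) same) dup) of λ ()
  parent≡neckρ : parent σ ≡ neck ρ
  parent≡neckρ = cong neck (parentWord-nonW1 σ notW₁)
  parent≡ρ : parent σ ≡ ρ
  parent≡ρ = trans parent≡neckρ (neck-necklace ρ (raise-preserves-necklace σ j b σ-nk j<n a<b last gap)
    (subst IsNecklace parent≡neckρ parent-nk))
  a∈ρ : a ∈ ρ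
  a∈ρ = count-pos⁻ ρ (≤-pred (subst (1 <_) (sym (count-setAt-removes σ j j<n b≢a)) 1<c))
    where
    b≢a : b ≢ a
    b≢a b≡a = <-irrefl (sym b≡a) a<b

LargestBelow : ℕ → Word → ℕ → Set
LargestBelow v ω y = y ∈ ω × y < v × (∀ z → z ∈ ω → z < v → z ≤ y)

module _ {σ ω} (raise : Raise σ ω) where
  open Raise raise

  at-ω-j : at ω j ≡ b
  at-ω-j = trans (cong (λ w → at w j) ω≡) (at-setAt-≡ σ j b j<n)

  raise-undone : ∀ i x y → (∀ {z} → z ∈ setAt ω i x → z ∈ σ) →
    (1 < at ω i → LargestBelow (at ω i) ω y) → setAt ω i y ≡ σ
  raise-undone i x y ⊆σ largest with i ≟ j
  ... | no i≢j = ⊥-elim (<-irrefl refl (gap b (⊆σ b∈ωx) a<b))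
    where
    j<∣ωx∣ : j < length (setAt ω i x)
    j<∣ωx∣ = subst (j <_) (sym (trans (length-setAt ω i x) (trans (cong length ω≡) (length-setAt σ j b))))
               j<n
    b∈ωx : b ∈ setAt ω i x
    b∈ωx = subst (_∈ setAt ω i x) (trans (at-setAt-≢ ω i x j (i≢j ∘ sym)) at-ω-j)
             (at-∈ (setAt ω i x) j j<∣ωx∣)
  ... | yes refl = begin
    setAt ω j y               ≡⟨ cong₂ (λ w v → setAt w j v) ω≡ (≤-antisym y≤a a≤y) ⟩
    setAt (setAt σ j b) j a   ≡⟨ setAt-setAt σ j b a ⟩
    setAt σ j a               ≡⟨ cong (setAt σ j) (sym σj≡a) ⟩
    setAt σ j (at σ j)        ≡⟨ setAt-at σ j ⟩
    σ                         ∎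
    where
    open ≡-Reasoning
    below : LargestBelow b ω y
    below = subst (λ v → LargestBelow v ω y) at-ω-j
              (largest (subst (1 <_) (sym at-ω-j) (≤-<-trans 0<a a<b)))
    a≤y : a ≤ y
    a≤y = proj₂ (proj₂ below) a a∈ω a<b
    y≤a : y ≤ a
    y≤a with ∈-setAt⁻ σ j b (subst (y ∈_) ω≡ (proj₁ below))
    ... | inj₁ y≡b = ⊥-elim (<-irrefl y≡b (proj₁ (proj₂ below)))
    ... | inj₂ y∈σ with a <? y
    ...   | yes a<y = ⊥-elim (<-asym (proj₁ (proj₂ below)) (gap y y∈σ a<y))
    ...   | no a≮y  = ≮⇒≥ a≮y

-- The remaining hypotheses (ω a weak order, i < n, the case w_i ≤ 1) are not needed:
-- a child can only arise at the raised position, where w_i > 1.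
lemma10 : (ω : Word) → IsWeakOrder ω → IsNecklace ω → ¬ InW1 ω →
    (i : ℕ) → i < length ω → (y : ℕ) →
    (1 < at ω i → y ∈ ω × y < at ω i × (∀ z → z ∈ ω → z < at ω i → z ≤ y)) →
    (at ω i ≤ 1 → y ≡ 1) →
    ¬ IsNecklace (setAt ω i y) →
    ¬ (∃ λ x → IsChild (neck (setAt ω i x)) ω)
lemma10 ω _ ω-nk ω∉W₁ i _ y largest _ ¬nk (x , _ , σ-wo , σ-nk , _ , parent≡ω) = cases (isW1B σ) refl
  where
  σ = neck (setAt ω i x)
  cases : ∀ β → isW1B σ ≡ β → ⊥
  cases true  σ∈W₁ = ω∉W₁ (subst InW1 parent≡ω (parent-InW1 σ σ∈W₁))
  cases false σ∉W₁ = ¬nk (subst IsNecklace (sym undone) σ-nk)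
    where
    raise : Raise σ ω
    raise = subst (Raise σ) parent≡ω
              (parent-Raise σ σ-wo σ-nk σ∉W₁ (subst IsNecklace (sym parent≡ω) ω-nk))
    undone : setAt ω i y ≡ σ
    undone = raise-undone raise i x y (∈-resp-↭ (↭-sym (neck-↭ (setAt ω i x)))) largest
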